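{- Let $(A,r)$ be a greedy system with respect to $(\mathcal{L},\preceq)$ and let $e\in E$. Let $\mathcal{L}'=\{L\in\mathcal{L}: e\notin L\}$. Then the system obtained from $(A,r)$ by keeping only the rows indexed by $\mathcal{L}'$ (with the restriction of $\preceq$ to $\mathcal{L}'$) is a greedy system.
   Context: Let $E$ be a finite set of columns (elements), $\mathcal{L}$ a finite set of row indices, $A=(a_{i,e})\in\mathbb{R}_{\ge 0}^{\mathcal{L}\times E}$ and $r:\mathcal{L}\to\mathbb{R}$. For a row $i$ let $\mathrm{supp}(i)=\{e\in E: a_{i,e}>0\}$. Let $\preceq$ be a partial order on $\mathcal{L}$. The system $(A,r)$ is a greedy system with respect to $(\mathcal{L},\preceq)$ if: (P1) $r(S)\le r(T)$ whenever $S\preceq T$; (P2) for every $e\in E$, $a_{S,e}\le a_{T,e}$ whenever $S\preceq T$; (P3) $(\mathcal{L},\preceq)$ is a modular lattice with join $\vee$ and meet $\wedge$, distinct rows have distinct supports, and for all $i,j\in\mathcal{L}$, $e\in E$: $e\notin\mathrm{supp}(i)\cup\mathrm{supp}(j)$ implies $e\notin\mathrm{supp}(i\vee j)$; (P4) $\frac{r(T)-r(S\wedge T)}{a_{T,e}}\le\frac{r(S\vee T)-r(S)}{a_{S\vee T,e}}$ for all $S,T\in\mathcal{L}$ and $e\in T\setminus(S\wedge T)$. Since supports are distinct, each row is identified with its support: $S\in\mathcal{L}$ denotes the row with support $S\subseteq E$, and $e\in S$ means $a_{S,e}>0$. -}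

module Defs where

open import Level using (0ℓ)
open import Data.Nat using (ℕ)
open import Data.Fin using (Fin)
open import Data.Product using (Σ; ∃; _×_; _,_)
open import Relation.Nullary using (¬_)
open import Relation.Binary.Core using (Rel)
open import Relation.Binary.PropositionalEquality using (_≡_)
open import Relation.Binary.Structures using (IsTotalOrder)
open import Relation.Binary.Lattice.Structures using (IsLattice)
open import Algebra.Structures using (IsCommutativeRing)
open import Algebra.Core using (Op₁; Op₂)
open import Function.Bundles using (_⇔_)

-- Ordered fields (the standard library has no real numbers; the greedy
-- system is stated over an arbitrary ordered field, ℝ being one instance).
-- Inverse is total, with 0⁻¹ unconstrained; it is only ever applied to
-- positive entries in the statement.

record OrderedField : Set₁ where
  infixl 6 _+_ _-_
  infixl 7 _*_ _/_
  infix  4 _≤_ _<_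
  field
    Carrier : Set
    _+_ _*_ : Op₂ Carrier
    -_      : Op₁ Carrier
    _⁻¹     : Op₁ Carrier
    0# 1#   : Carrier
    _≤_     : Rel Carrier 0ℓ
    isCommutativeRing : IsCommutativeRing _≡_ _+_ _*_ -_ 0# 1#
    isTotalOrder      : IsTotalOrder _≡_ _≤_
    0≢1       : ¬ (0# ≡ 1#)
    inverseʳ  : ∀ x → ¬ (x ≡ 0#) → x * (x ⁻¹) ≡ 1#
    +-mono-≤  : ∀ x y z → x ≤ y → x + z ≤ y + z
    *-nonneg  : ∀ x y → 0# ≤ x → 0# ≤ y → 0# ≤ x * y

  _<_ : Rel Carrier 0ℓ
  x < y = x ≤ y × ¬ (x ≡ y)

  _-_ : Op₂ Carrier
  x - y = x + (- y)

  _/_ : Op₂ Carrier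
  x / y = x * (y ⁻¹)

-- Greedy systems.
-- Rows are indexed by a type ℒ with a relation _⪯_; columns by Fin n.
-- a i e is the entry a_{i,e}; e ∈ supp(i) means 0 < a i e.

module _ (F : OrderedField) where
  open OrderedField F

  Modular : {ℒ : Set} → Rel ℒ 0ℓ → Op₂ ℒ → Op₂ ℒ → Set
  Modular {ℒ} _⪯_ _∨_ _∧_ = ∀ (x y z : ℒ) → x ⪯ z → (x ∨ (y ∧ z)) ≡ ((x ∨ y) ∧ z)

  P3P4 : {n : ℕ} {ℒ : Set} → Rel ℒ 0ℓ → (ℒ → Fin n → Carrier) → (ℒ → Carrier)
         → Op₂ ℒ → Op₂ ℒ → Set
  P3P4 {n} {ℒ} _⪯_ a r _∨_ _∧_ =
      IsLattice _≡_ _⪯_ _∨_ _∧_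
    × Modular _⪯_ _∨_ _∧_
    × (∀ (i j : ℒ) → (∀ (e : Fin n) → (0# < a i e) ⇔ (0# < a j e)) → i ≡ j)
    × (∀ (i j : ℒ) (e : Fin n) → ¬ (0# < a i e) → ¬ (0# < a j e) → ¬ (0# < a (i ∨ j) e))
    × (∀ (S T : ℒ) (e : Fin n) → 0# < a T e → ¬ (0# < a (S ∧ T) e) →
         (r T - r (S ∧ T)) / a T e ≤ (r (S ∨ T) - r S) / a (S ∨ T) e)

  IsGreedy : {n : ℕ} {ℒ : Set} → Rel ℒ 0ℓ → (ℒ → Fin n → Carrier) → (ℒ → Carrier) → Set
  IsGreedy {n} {ℒ} _⪯_ a r =
      (∀ (i : ℒ) (e : Fin n) → 0# ≤ a i e)
    × (∀ (S T : ℒ) → S ⪯ T → r S ≤ r T)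
    × (∀ (S T : ℒ) (e : Fin n) → S ⪯ T → a S e ≤ a T e)
    × Σ (Op₂ ℒ) (λ _∨_ → Σ (Op₂ ℒ) (λ _∧_ → P3P4 _⪯_ a r _∨_ _∧_))

module Submission where

open import Defs
open import Data.Nat using (ℕ)
open import Data.Fin using (Fin)
open import Data.Product using (∃; _,_; proj₁; proj₂)
open import Relation.Nullary using (¬_)
open import Relation.Binary.Core using (Rel)
open import Relation.Binary.PropositionalEquality
  using (_≡_; refl; cong; isEquivalence; module ≡-Reasoning)
open import Relation.Binary.Structures using (IsTotalOrder)
open import Relation.Binary.Lattice.Structures using (IsLattice)
open import Relation.Binary.Lattice.Definitions using (Supremum; Infimum)
open import Level using (0ℓ)
open import Function.Base using (_∘_)
open import Function.Definitions using (Injective)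
open import Function.Bundles using (_⇔_; module Equivalence)
open import Algebra.Core using (Op₂)

-- ℒ' is closed under ∨ by (P3) and under ∧ because, by (P2), it is a down-set.
-- Hence ℒ' is a sublattice of a modular lattice, so it is a modular lattice,
-- and (P1), (P2), (P3), (P4) are inherited since every join and meet in ℒ'
-- is the one computed in ℒ.

module Enumeration {A B : Set} (P : A → Set) (ι : B → A)
                   (image : ∀ x → P x ⇔ ∃ λ j → ι j ≡ x) where
  open Equivalence

  P-ι : ∀ i → P (ι i)
  P-ι i = from (image (ι i)) (i , refl)

  preimage-op : (op : Op₂ A) → (∀ x y → P x → P y → P (op x y)) →
                ∀ i j → ∃ λ k → ι k ≡ op (ι i) (ι j)
  preimage-op op closed i j = to (image _) (closed _ _ (P-ι i) (P-ι j))

  restrict : (op : Op₂ A) → (∀ x y → P x → P y → P (op x y)) → Op₂ B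
  restrict op closed i j = proj₁ (preimage-op op closed i j)

  ι-restrict : ∀ op closed i j → ι (restrict op closed i j) ≡ op (ι i) (ι j)
  ι-restrict op closed i j = proj₂ (preimage-op op closed i j)

module _ (F : OrderedField) where
  open OrderedField F
  open IsTotalOrder isTotalOrder using (antisym) renaming (trans to ≤-trans)

  <-≤-trans : ∀ {x y z} → x < y → y ≤ z → x < z
  <-≤-trans (x≤y , x≢y) y≤z = ≤-trans x≤y y≤z , λ { refl → x≢y (antisym x≤y y≤z) }

  module _ {ℒ ℒ' : Set} {_⪯_ : Rel ℒ 0ℓ} {_∨_ _∧_ : Op₂ ℒ} {_∨'_ _∧'_ : Op₂ ℒ'}
           (ι : ℒ' → ℒ) (ι-injective : Injective _≡_ _≡_ ι)
           (ι-∨ : ∀ i j → ι (i ∨' j) ≡ ι i ∨ ι j)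
           (ι-∧ : ∀ i j → ι (i ∧' j) ≡ ι i ∧ ι j) where

    isLattice-pullback : IsLattice _≡_ _⪯_ _∨_ _∧_ →
                         IsLattice _≡_ (λ i j → ι i ⪯ ι j) _∨'_ _∧'_
    isLattice-pullback lattice = record
      { isPartialOrder = record
        { isPreorder = record
          { isEquivalence = isEquivalence
          ; reflexive = λ { refl → ⪯-refl }
          ; trans = ⪯-trans }
        ; antisym = λ i⪯j j⪯i → ι-injective (⪯-antisym i⪯j j⪯i) }
      ; supremum = supremum'
      ; infimum = infimum' }
      where
      open IsLattice lattice
        renaming (refl to ⪯-refl; trans to ⪯-trans; antisym to ⪯-antisym)
        using (x≤x∨y; y≤x∨y; ∨-least; x∧y≤x; x∧y≤y; ∧-greatest)

      supremum' : Supremum (λ i j → ι i ⪯ ι j) _∨'_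
      supremum' i j rewrite ι-∨ i j = x≤x∨y _ _ , y≤x∨y _ _ , λ k → ∨-least

      infimum' : Infimum (λ i j → ι i ⪯ ι j) _∧'_
      infimum' i j rewrite ι-∧ i j = x∧y≤x _ _ , x∧y≤y _ _ , λ k → ∧-greatest

    modular-pullback : Modular F _⪯_ _∨_ _∧_ → Modular F (λ i j → ι i ⪯ ι j) _∨'_ _∧'_
    modular-pullback modular x y z x⪯z = ι-injective (begin
      ι (x ∨' (y ∧' z))    ≡⟨ ι-∨ x (y ∧' z) ⟩
      ι x ∨ ι (y ∧' z)     ≡⟨ cong (ι x ∨_) (ι-∧ y z) ⟩
      ι x ∨ (ι y ∧ ι z)    ≡⟨ modular (ι x) (ι y) (ι z) x⪯z ⟩
      (ι x ∨ ι y) ∧ ι z    ≡⟨ cong (_∧ ι z) (ι-∨ x y) ⟨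
      ι (x ∨' y) ∧ ι z     ≡⟨ ι-∧ (x ∨' y) z ⟨
      ι ((x ∨' y) ∧' z)    ∎)
      where open ≡-Reasoning

    P3P4-pullback : ∀ {n} {a : ℒ → Fin n → Carrier} {r : ℒ → Carrier} →
                    P3P4 F _⪯_ a r _∨_ _∧_ →
                    P3P4 F (λ i j → ι i ⪯ ι j) (a ∘ ι) (r ∘ ι) _∨'_ _∧'_
    P3P4-pullback {n} {a} {r} (lattice , modular , supp-injective , supp-∨ , exchange) =
        isLattice-pullback lattice
      , modular-pullback modular
      , (λ i j same-supp → ι-injective (supp-injective (ι i) (ι j) same-supp))
      , supp-∨'
      , exchange'
      where
      supp-∨' : ∀ i j f → ¬ (0# < a (ι i) f) → ¬ (0# < a (ι j) f) → ¬ (0# < a (ι (i ∨' j)) f)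
      supp-∨' i j f rewrite ι-∨ i j = supp-∨ (ι i) (ι j) f

      exchange' : ∀ S T f → 0# < a (ι T) f → ¬ (0# < a (ι (S ∧' T)) f) →
                  (r (ι T) - r (ι (S ∧' T))) / a (ι T) f ≤ (r (ι (S ∨' T)) - r (ι S)) / a (ι (S ∨' T)) f
      exchange' S T f rewrite ι-∧ S T | ι-∨ S T = exchange (ι S) (ι T) f

lemma2 : (F : OrderedField) → (n m : ℕ) → (_⪯_ : Rel (Fin m) 0ℓ)
    → (a : Fin m → Fin n → OrderedField.Carrier F) → (r : Fin m → OrderedField.Carrier F)
    → IsGreedy F _⪯_ a r → (e : Fin n)
    → (k : ℕ) → (ι : Fin k → Fin m) → Injective _≡_ _≡_ ι
    → (∀ (L : Fin m) → (¬ (OrderedField._<_ F (OrderedField.0# F) (a L e))) ⇔ (∃ λ (j : Fin k) → ι j ≡ L))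
    → IsGreedy F (λ i j → ι i ⪯ ι j) (λ i → a (ι i)) (λ i → r (ι i))
lemma2 F n m _⪯_ a r
       (nonneg , r-mono , a-mono , _∨_ , _∧_ , p3p4@(lattice , _ , _ , supp-∨ , _))
       e k ι ι-injective image =
    (λ i → nonneg (ι i)) , (λ S T → r-mono (ι S) (ι T)) , (λ S T → a-mono (ι S) (ι T))
  , _ , _ , P3P4-pullback F ι ι-injective (ι-restrict _ ∉-∨) (ι-restrict _ ∉-∧) p3p4
  where
  open OrderedField F
  open IsLattice lattice using (x∧y≤x)

  _∉_ : Fin n → Fin m → Set
  f ∉ L = ¬ (0# < a L f)

  open Enumeration (e ∉_) ι image

  ∉-∨ : ∀ S T → e ∉ S → e ∉ T → e ∉ (S ∨ T)
  ∉-∨ S T = supp-∨ S T e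

  ∉-∧ : ∀ S T → e ∉ S → e ∉ T → e ∉ (S ∧ T)
  ∉-∧ S T e∉S _ e∈S∧T = e∉S (<-≤-trans F e∈S∧T (a-mono (S ∧ T) S e (x∧y≤x S T)))
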